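{- A \(\mathcal V\)-dcpo \(D\) is pseudocontinuous if and only if the monotone map of posets \(\bigsqcup_{\approx}:\mathrm{Ind}_{\mathcal V}(D)/{\approx}\to D\) has a (necessarily unique) left adjoint.
   Context: We work constructively and predicatively in univalent foundations with universes, propositional truncation and set quotients. Directed family: inhabited index and any two indices have (there exists) a common upper index. \(\mathcal V\)-dcpo: poset with suprema \(\bigsqcup\alpha\) of directed families indexed by types in \(\mathcal V\). Way-below: \(x\ll y\) iff for every directed \(\alpha:I\to D\), \(I:\mathcal V\), with \(y\sqsubseteq\bigsqcup\alpha\) there exists \(i\) with \(x\sqsubseteq\alpha_i\). A directed family \(\alpha\) approximates \(x\) if \(\bigsqcup\alpha = x\) and each \(\alpha_i\ll x\). \(D\) is pseudocontinuous if for every \(x:D\) there exists (propositionally truncated) a directed family indexed by a type in \(\mathcal V\) that approximates \(x\). The \(\mathcal V\)-ind-completion \(\mathrm{Ind}_{\mathcal V}(D)\) is the type of directed families into \(D\) indexed by types in \(\mathcal V\), preordered by \(\alpha\lesssim\beta\) iff for every \(i\) there exists \(j\) with \(\alpha_i\sqsubseteq\beta_j\). \(\mathrm{Ind}_{\mathcal V}(D)/{\approx}\) is its poset reflection, the quotient by \(\alpha\approx\beta\) iff \(\alpha\lesssim\beta\) and \(\beta\lesssim\alpha\), with the induced order, and \(\bigsqcup_{\approx}\) is the unique monotone map with \(\bigsqcup_{\approx}[\alpha] = \bigsqcup\alpha\). A left adjoint to it is a map \(L:D\to\mathrm{Ind}_{\mathcal V}(D)/{\approx}\) with \(L(x)\le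 Q \iff x\sqsubseteq\bigsqcup_{\approx}Q\) for all \(x\) and \(Q\). -}

{-# OPTIONS --without-K #-}
module Defs where

open import Level using (Level; _⊔_; suc; Setω)
open import Data.Product using (Σ; Σ-syntax; _×_; _,_; proj₁; proj₂)
open import Relation.Binary.PropositionalEquality using (_≡_; refl; sym; trans)
open import Relation.Binary.Structures using (IsEquivalence)

is-prop : ∀ {ℓ} → Set ℓ → Set ℓ
is-prop A = (x y : A) → x ≡ y

is-set : ∀ {ℓ} → Set ℓ → Set ℓ
is-set A = {x y : A} → is-prop (x ≡ y)

record PropTrunc : Setω where
  field
    ∥_∥      : ∀ {ℓ} → Set ℓ → Set ℓ
    ∥∥-is-prop : ∀ {ℓ} {A : Set ℓ} → is-prop ∥ A ∥
    ∣_∣      : ∀ {ℓ} {A : Set ℓ} → A → ∥ A ∥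
    ∥∥-rec   : ∀ {ℓ ℓ'} {A : Set ℓ} {P : Set ℓ'} → is-prop P → (A → P) → ∥ A ∥ → P

  ∃ : ∀ {ℓ ℓ'} {A : Set ℓ} → (A → Set ℓ') → Set (ℓ ⊔ ℓ')
  ∃ {A = A} B = ∥ Σ A B ∥

record SetQuotients (pt : PropTrunc) : Setω where
  open PropTrunc pt
  field
    _/[_]_ : ∀ {ℓ ℓ'} (X : Set ℓ) (R : X → X → Set ℓ') → IsEquivalence R → Set (ℓ ⊔ ℓ')
    /-is-set : ∀ {ℓ ℓ'} {X : Set ℓ} {R : X → X → Set ℓ'} (e : IsEquivalence R)
             → is-set (X /[ R ] e)
    η/ : ∀ {ℓ ℓ'} {X : Set ℓ} {R : X → X → Set ℓ'} (e : IsEquivalence R)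
       → X → X /[ R ] e
    η/-identifies : ∀ {ℓ ℓ'} {X : Set ℓ} {R : X → X → Set ℓ'} (e : IsEquivalence R)
                  → {x y : X} → R x y → η/ e x ≡ η/ e y
    η/-effective : ∀ {ℓ ℓ'} {X : Set ℓ} {R : X → X → Set ℓ'} (e : IsEquivalence R)
                 → {x y : X} → η/ e x ≡ η/ e y → ∥ R x y ∥
    /-rec : ∀ {ℓ ℓ' ℓ''} {X : Set ℓ} {R : X → X → Set ℓ'} (e : IsEquivalence R)
            {A : Set ℓ''} → is-set A → (f : X → A)
          → (∀ {x y} → R x y → f x ≡ f y) → X /[ R ] e → A
    /-rec-comp : ∀ {ℓ ℓ' ℓ''} {X : Set ℓ} {R : X → X → Set ℓ'} (e : IsEquivalence R)
                 {A : Set ℓ''} (s : is-set A) (f : X → A)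
                 (p : ∀ {x y} → R x y → f x ≡ f y) (x : X)
               → /-rec e s f p (η/ e x) ≡ f x
    /-induction : ∀ {ℓ ℓ' ℓ''} {X : Set ℓ} {R : X → X → Set ℓ'} (e : IsEquivalence R)
                  (P : X /[ R ] e → Set ℓ'') → (∀ q → is-prop (P q))
                → (∀ x → P (η/ e x)) → ∀ q → P q

module _ (pt : PropTrunc) where
  open PropTrunc pt

  is-directed : ∀ {𝓥 𝓤 𝓣} {D : Set 𝓤} (_⊑_ : D → D → Set 𝓣) {I : Set 𝓥}
              → (I → D) → Set (𝓥 ⊔ 𝓣)
  is-directed _⊑_ {I} α =
    ∥ I ∥ × ((i j : I) → ∃ λ (k : I) → (α i ⊑ α k) × (α j ⊑ α k))

  record DCPO (𝓥 𝓤 𝓣 : Level) : Set (suc 𝓥 ⊔ suc 𝓤 ⊔ suc 𝓣) where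
    field
      ⟨_⟩        : Set 𝓤
      _⊑_        : ⟨_⟩ → ⟨_⟩ → Set 𝓣
      carrier-is-set : is-set ⟨_⟩
      ⊑-prop     : (x y : ⟨_⟩) → is-prop (x ⊑ y)
      ⊑-refl     : (x : ⟨_⟩) → x ⊑ x
      ⊑-trans    : {x y z : ⟨_⟩} → x ⊑ y → y ⊑ z → x ⊑ z
      ⊑-antisym  : {x y : ⟨_⟩} → x ⊑ y → y ⊑ x → x ≡ y
      ⨆          : {I : Set 𝓥} (α : I → ⟨_⟩) → is-directed _⊑_ α → ⟨_⟩
      ⨆-upper    : {I : Set 𝓥} (α : I → ⟨_⟩) (δ : is-directed _⊑_ α)
                 → (i : I) → α i ⊑ ⨆ α δ
      ⨆-lowest   : {I : Set 𝓥} (α : I → ⟨_⟩) (δ : is-directed _⊑_ α)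
                 → (u : ⟨_⟩) → ((i : I) → α i ⊑ u) → ⨆ α δ ⊑ u

  module _ {𝓥 𝓤 𝓣 : Level} (D : DCPO 𝓥 𝓤 𝓣) where
    open DCPO D

    _≪_ : ⟨_⟩ → ⟨_⟩ → Set (suc 𝓥 ⊔ 𝓤 ⊔ 𝓣)
    x ≪ y = {I : Set 𝓥} (α : I → ⟨_⟩) (δ : is-directed _⊑_ α)
          → y ⊑ ⨆ α δ → ∃ λ (i : I) → x ⊑ α i

    Ind : Set (suc 𝓥 ⊔ 𝓤 ⊔ 𝓣)
    Ind = Σ[ I ∈ Set 𝓥 ] Σ[ α ∈ (I → ⟨_⟩) ] is-directed _⊑_ α

    ⨆Ind : Ind → ⟨_⟩
    ⨆Ind (I , α , δ) = ⨆ α δ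

    approximates : Ind → ⟨_⟩ → Set (suc 𝓥 ⊔ 𝓤 ⊔ 𝓣)
    approximates (I , α , δ) x = (⨆ α δ ≡ x) × ((i : I) → α i ≪ x)

    is-pseudocontinuous : Set (suc 𝓥 ⊔ 𝓤 ⊔ 𝓣)
    is-pseudocontinuous = (x : ⟨_⟩) → ∃ λ (σ : Ind) → approximates σ x

    _≲_ : Ind → Ind → Set (𝓥 ⊔ 𝓣)
    (I , α , _) ≲ (J , β , _) = (i : I) → ∃ λ (j : J) → α i ⊑ β j

    _≈_ : Ind → Ind → Set (𝓥 ⊔ 𝓣)
    σ ≈ τ = (σ ≲ τ) × (τ ≲ σ)

    ≲-refl : (σ : Ind) → σ ≲ σ
    ≲-refl (I , α , _) i = ∣ i , ⊑-refl (α i) ∣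

    ≲-trans : {σ τ ρ : Ind} → σ ≲ τ → τ ≲ ρ → σ ≲ ρ
    ≲-trans {I , α , _} {J , β , _} {K , γ , _} p q i =
      ∥∥-rec ∥∥-is-prop
        (λ { (j , a) → ∥∥-rec ∥∥-is-prop
               (λ { (k , b) → ∣ k , ⊑-trans a b ∣ }) (q j) })
        (p i)

    ≈-equiv : IsEquivalence _≈_
    ≈-equiv = record
      { refl  = λ {σ} → ≲-refl σ , ≲-refl σ
      ; sym   = λ { (p , q) → q , p }
      ; trans = λ {σ} {τ} {ρ} → λ { (p , q) (p' , q') → ≲-trans {σ} {τ} {ρ} p p' , ≲-trans {ρ} {τ} {σ} q' q }
      }

    ⨆-≲ : {σ τ : Ind} → σ ≲ τ → ⨆Ind σ ⊑ ⨆Ind τ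
    ⨆-≲ {I , α , δ} {J , β , ε} p =
      ⨆-lowest α δ (⨆ β ε) λ i →
        ∥∥-rec (⊑-prop (α i) (⨆ β ε))
          (λ { (j , a) → ⊑-trans a (⨆-upper β ε j) }) (p i)

    ⨆-respects-≈ : {σ τ : Ind} → σ ≈ τ → ⨆Ind σ ≡ ⨆Ind τ
    ⨆-respects-≈ (p , q) = ⊑-antisym (⨆-≲ p) (⨆-≲ q)

  module _ (sq : SetQuotients pt) {𝓥 𝓤 𝓣 : Level} (D : DCPO 𝓥 𝓤 𝓣) where
    open SetQuotients sq
    open DCPO D

    Ind/≈ : Set (suc 𝓥 ⊔ 𝓤 ⊔ 𝓣)
    Ind/≈ = Ind D /[ _≈_ D ] ≈-equiv D

    [_] : Ind D → Ind/≈
    [_] = η/ (≈-equiv D)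

    -- the induced order on the quotient: [σ] ≤ [τ] iff σ ≲ τ
    -- (well defined since ≲ respects ≈)
    _≤/_ : Ind/≈ → Ind/≈ → Set (suc 𝓥 ⊔ 𝓤 ⊔ 𝓣)
    P ≤/ Q = ∃ λ (σ : Ind D) → Σ[ τ ∈ Ind D ]
               ([ σ ] ≡ P) × ([ τ ] ≡ Q) × _≲_ D σ τ

    ⨆≈ : Ind/≈ → ⟨_⟩
    ⨆≈ = /-rec (≈-equiv D) carrier-is-set (⨆Ind D) (⨆-respects-≈ D)

    is-left-adjoint-to-⨆≈ : (⟨_⟩ → Ind/≈) → Set (suc 𝓥 ⊔ 𝓤 ⊔ 𝓣)
    is-left-adjoint-to-⨆≈ L =
      (x : ⟨_⟩) (Q : Ind/≈) → ((L x ≤/ Q) → (x ⊑ ⨆≈ Q)) × ((x ⊑ ⨆≈ Q) → (L x ≤/ Q))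

    ⨆≈-has-left-adjoint : Set (suc 𝓥 ⊔ 𝓤 ⊔ 𝓣)
    ⨆≈-has-left-adjoint = Σ[ L ∈ (⟨_⟩ → Ind/≈) ] is-left-adjoint-to-⨆≈ L

{-# OPTIONS --without-K #-}
-- [σ] is the value at x of a left adjoint of ⨆≈ exactly when σ ≲ τ ⇔ x ⊑ ⨆ τ
-- for all directed τ, and that condition says precisely that σ approximates x:
-- taking τ = σ and τ = the constant family at x gives ⨆ σ = x, and the backward
-- implication is the way-below property of every σ i.  Such σ are unique up to ≈,
-- so a truncated choice of approximating family yields an honest map D → Ind/≈.
module Submission where

open import Defs using (PropTrunc; SetQuotients; DCPO; is-prop; is-pseudocontinuous; ⨆≈-has-left-adjoint)
import Defs
open import Level using (Level; _⊔_) renaming (suc to lsuc)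
open import Data.Product using (_×_; Σ; _,_; proj₁; proj₂)
open import Data.Unit.Polymorphic using (⊤; tt)
open import Relation.Binary.PropositionalEquality using (_≡_; refl; sym; cong; subst)

Σ-≡-prop : ∀ {a b} {A : Set a} {B : A → Set b} → (∀ x → is-prop (B x))
         → {u v : A} → u ≡ v → (p : B u) (p' : B v) → _≡_ {A = Σ A B} (u , p) (v , p')
Σ-≡-prop B-prop refl p p' = cong (_ ,_) (B-prop _ p p')

module Notation (pt : PropTrunc) {𝓥 𝓤 𝓣 : Level} (D : DCPO pt 𝓥 𝓤 𝓣) where
  open DCPO D public

  Ind : Set (lsuc 𝓥 ⊔ 𝓤 ⊔ 𝓣)
  Ind = Defs.Ind pt D

  ⨆Ind : Ind → ⟨_⟩
  ⨆Ind = Defs.⨆Ind pt D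

  _≲_ _≈_ : Ind → Ind → Set (𝓥 ⊔ 𝓣)
  _≲_ = Defs._≲_ pt D
  _≈_ = Defs._≈_ pt D

  approximates : Ind → ⟨_⟩ → Set (lsuc 𝓥 ⊔ 𝓤 ⊔ 𝓣)
  approximates = Defs.approximates pt D

  ≲-refl : (σ : Ind) → σ ≲ σ
  ≲-refl = Defs.≲-refl pt D

  ≲-trans : {σ τ ρ : Ind} → σ ≲ τ → τ ≲ ρ → σ ≲ ρ
  ≲-trans {σ} {τ} {ρ} = Defs.≲-trans pt D {σ} {τ} {ρ}

  ⨆-≲ : {σ τ : Ind} → σ ≲ τ → ⨆Ind σ ⊑ ⨆Ind τ
  ⨆-≲ {σ} {τ} = Defs.⨆-≲ pt D {σ} {τ}

  ≡⇒⊑ : {x y : ⟨_⟩} → x ≡ y → x ⊑ y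
  ≡⇒⊑ {x} refl = ⊑-refl x

module IndAdjoint (pt : PropTrunc) {𝓥 𝓤 𝓣 : Level} (D : DCPO pt 𝓥 𝓤 𝓣) where
  open PropTrunc pt
  open Notation pt D

  constant : ⟨_⟩ → Ind
  constant x = ⊤ , (λ _ → x) , ∣ tt ∣ , λ _ _ → ∣ tt , ⊑-refl x , ⊑-refl x ∣

  ⨆-constant : (x : ⟨_⟩) → ⨆Ind (constant x) ≡ x
  ⨆-constant x = ⊑-antisym (⨆-lowest _ _ x (λ _ → ⊑-refl x)) (⨆-upper _ _ tt)

  ⨆-adjoint-at : ⟨_⟩ → Ind → Set (lsuc 𝓥 ⊔ 𝓤 ⊔ 𝓣)
  ⨆-adjoint-at x σ = (τ : Ind) → (σ ≲ τ → x ⊑ ⨆Ind τ) × (x ⊑ ⨆Ind τ → σ ≲ τ)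

  approximates⇒⨆-adjoint-at : ∀ {x σ} → approximates σ x → ⨆-adjoint-at x σ
  approximates⇒⨆-adjoint-at {σ = σ} (refl , ≪x) τ@(_ , β , ε) =
    ⨆-≲ {σ} {τ} , λ x⊑⨆β i → ≪x i β ε x⊑⨆β

  ⨆-adjoint-at⇒approximates : ∀ {x σ} → ⨆-adjoint-at x σ → approximates σ x
  ⨆-adjoint-at⇒approximates {x} {σ@(_ , α , δ)} adj =
    ⊑-antisym ⨆σ⊑x x⊑⨆σ , λ i β ε x⊑⨆β → proj₂ (adj (_ , β , ε)) x⊑⨆β i
    where
    x⊑⨆σ : x ⊑ ⨆ α δ
    x⊑⨆σ = proj₁ (adj σ) (≲-refl σ)

    ⨆σ⊑x : ⨆ α δ ⊑ x
    ⨆σ⊑x = ⊑-trans (⨆-≲ {σ} {constant x} (proj₂ (adj (constant x)) (≡⇒⊑ (sym (⨆-constant x)))))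
                    (≡⇒⊑ (⨆-constant x))

  ⨆-adjoint-at-≲ : ∀ {x σ τ} → ⨆-adjoint-at x σ → ⨆-adjoint-at x τ → σ ≲ τ
  ⨆-adjoint-at-≲ {τ = τ} adjσ adjτ = proj₂ (adjσ τ) (proj₁ (adjτ τ) (≲-refl τ))

  ⨆-adjoint-at-unique : ∀ {x σ τ} → ⨆-adjoint-at x σ → ⨆-adjoint-at x τ → σ ≈ τ
  ⨆-adjoint-at-unique {x} {σ} {τ} adjσ adjτ =
    ⨆-adjoint-at-≲ {x} {σ} {τ} adjσ adjτ , ⨆-adjoint-at-≲ {x} {τ} {σ} adjτ adjσ

module QuotientAdjoint (pt : PropTrunc) (sq : SetQuotients pt) {𝓥 𝓤 𝓣 : Level} (D : DCPO pt 𝓥 𝓤 𝓣) where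
  open PropTrunc pt
  open SetQuotients sq
  open Notation pt D
  open IndAdjoint pt D

  Ind/≈ : Set (lsuc 𝓥 ⊔ 𝓤 ⊔ 𝓣)
  Ind/≈ = Defs.Ind/≈ pt sq D

  [_] : Ind → Ind/≈
  [_] = Defs.[_] pt sq D

  _≤/_ : Ind/≈ → Ind/≈ → Set (lsuc 𝓥 ⊔ 𝓤 ⊔ 𝓣)
  _≤/_ = Defs._≤/_ pt sq D

  ⨆≈ : Ind/≈ → ⟨_⟩
  ⨆≈ = Defs.⨆≈ pt sq D

  []-surjective : (Q : Ind/≈) → ∃ λ σ → [ σ ] ≡ Q
  []-surjective = /-induction _ (λ Q → ∃ λ σ → [ σ ] ≡ Q) (λ _ → ∥∥-is-prop) (λ σ → ∣ σ , refl ∣)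

  -- Without function extensionality an implication between propositions is not itself
  -- known to be a proposition, so /-induction cannot be applied to it directly.
  /-induction-→ : ∀ {ℓ ℓ'} {A : Ind/≈ → Set ℓ} {B : Ind/≈ → Set ℓ'} → (∀ Q → is-prop (B Q))
                → (∀ σ → A [ σ ] → B [ σ ]) → ∀ Q → A Q → B Q
  /-induction-→ B-prop f Q a =
    ∥∥-rec (B-prop Q) (λ { (σ , refl) → f σ a }) ([]-surjective Q)

  ⨆≈-[] : (σ : Ind) → ⨆≈ [ σ ] ≡ ⨆Ind σ
  ⨆≈-[] = /-rec-comp _ carrier-is-set ⨆Ind (Defs.⨆-respects-≈ pt D)

  ≲⇒≤/ : {σ τ : Ind} → σ ≲ τ → [ σ ] ≤/ [ τ ]
  ≲⇒≤/ {σ} {τ} l = ∣ σ , τ , refl , refl , l ∣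

  ≤/⇒≲ : {σ τ : Ind} → [ σ ] ≤/ [ τ ] → σ ≲ τ
  ≤/⇒≲ {σ@(_ , α , _)} {τ} h i = ∥∥-rec ∥∥-is-prop
    (λ { (σ' , τ' , p , q , l) →
      ∥∥-rec ∥∥-is-prop (λ σ≈σ' → ∥∥-rec ∥∥-is-prop (λ τ'≈τ →
        ≲-trans {σ} {σ'} {τ} (proj₁ σ≈σ') (≲-trans {σ'} {τ'} {τ} l (proj₁ τ'≈τ)) i)
        (η/-effective _ q))
        (η/-effective _ (sym p)) })
    h

  ⨆≈-adjoint-at : ⟨_⟩ → Ind/≈ → Set (lsuc 𝓥 ⊔ 𝓤 ⊔ 𝓣)
  ⨆≈-adjoint-at x q = (Q : Ind/≈) → (q ≤/ Q → x ⊑ ⨆≈ Q) × (x ⊑ ⨆≈ Q → q ≤/ Q)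

  ⨆-adjoint-at⇒⨆≈-adjoint-at : ∀ {x σ} → ⨆-adjoint-at x σ → ⨆≈-adjoint-at x [ σ ]
  ⨆-adjoint-at⇒⨆≈-adjoint-at {x} {σ} adj Q =
    /-induction-→ {A = [ σ ] ≤/_} {B = λ Q → x ⊑ ⨆≈ Q} (λ _ → ⊑-prop _ _)
      (λ τ l → subst (x ⊑_) (sym (⨆≈-[] τ)) (proj₁ (adj τ) (≤/⇒≲ l))) Q ,
    /-induction-→ {A = λ Q → x ⊑ ⨆≈ Q} {B = [ σ ] ≤/_} (λ _ → ∥∥-is-prop)
      (λ τ x⊑⨆τ → ≲⇒≤/ (proj₂ (adj τ) (subst (x ⊑_) (⨆≈-[] τ) x⊑⨆τ))) Q

  ⨆≈-adjoint-at⇒⨆-adjoint-at : ∀ {x σ} → ⨆≈-adjoint-at x [ σ ] → ⨆-adjoint-at x σ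
  ⨆≈-adjoint-at⇒⨆-adjoint-at {x} adj τ =
    (λ l → subst (x ⊑_) (⨆≈-[] τ) (proj₁ (adj [ τ ]) (≲⇒≤/ l))) ,
    (λ x⊑⨆τ → ≤/⇒≲ (proj₂ (adj [ τ ]) (subst (x ⊑_) (sym (⨆≈-[] τ)) x⊑⨆τ)))

  ⨆≈-adjoint-at-from-∃ : ∀ {x q} → ∃ (λ σ → ([ σ ] ≡ q) × ⨆-adjoint-at x σ) → ⨆≈-adjoint-at x q
  ⨆≈-adjoint-at-from-∃ {x} {q} r Q =
    (λ h → ∥∥-rec (⊑-prop _ _) (λ s → proj₁ (from s) h) r) ,
    (λ h → ∥∥-rec ∥∥-is-prop (λ s → proj₂ (from s) h) r)
    where
    from : Σ Ind (λ σ → ([ σ ] ≡ q) × ⨆-adjoint-at x σ) → (q ≤/ Q → x ⊑ ⨆≈ Q) × (x ⊑ ⨆≈ Q → q ≤/ Q)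
    from (σ , refl , adj) = ⨆-adjoint-at⇒⨆≈-adjoint-at adj Q

  pseudocontinuous⇒⨆≈-has-left-adjoint : is-pseudocontinuous pt D → ⨆≈-has-left-adjoint pt sq D
  pseudocontinuous⇒⨆≈-has-left-adjoint pc =
    (λ x → proj₁ (value x)) , λ x → ⨆≈-adjoint-at-from-∃ (proj₂ (value x))
    where
    Value : ⟨_⟩ → Set (lsuc 𝓥 ⊔ 𝓤 ⊔ 𝓣)
    Value x = Σ Ind/≈ λ q → ∃ λ σ → ([ σ ] ≡ q) × ⨆-adjoint-at x σ

    Value-is-prop : ∀ x → is-prop (Value x)
    Value-is-prop x (q , r) (q' , r') =
      Σ-≡-prop (λ _ → ∥∥-is-prop)
        (∥∥-rec (/-is-set _) (λ s → ∥∥-rec (/-is-set _) (same-class s) r') r) r r'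
      where
      same-class : Σ Ind (λ σ → ([ σ ] ≡ q) × ⨆-adjoint-at x σ)
                 → Σ Ind (λ σ → ([ σ ] ≡ q') × ⨆-adjoint-at x σ) → q ≡ q'
      same-class (σ , refl , adjσ) (τ , refl , adjτ) = η/-identifies _ (⨆-adjoint-at-unique {x} {σ} {τ} adjσ adjτ)

    value : ∀ x → Value x
    value x = ∥∥-rec (Value-is-prop x)
      (λ { (σ , a) → [ σ ] , ∣ σ , refl , approximates⇒⨆-adjoint-at a ∣ }) (pc x)

  ⨆≈-has-left-adjoint⇒pseudocontinuous : ⨆≈-has-left-adjoint pt sq D → is-pseudocontinuous pt D
  ⨆≈-has-left-adjoint⇒pseudocontinuous (L , adj) x = ∥∥-rec ∥∥-is-prop
    (λ { (σ , p) → ∣ σ , ⨆-adjoint-at⇒approximates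
                          (⨆≈-adjoint-at⇒⨆-adjoint-at (subst (⨆≈-adjoint-at x) (sym p) (adj x))) ∣ })
    ([]-surjective (L x))

proposition4p14 : {𝓥 𝓤 𝓣 : Level} (pt : PropTrunc) (sq : SetQuotients pt)
    (D : DCPO pt 𝓥 𝓤 𝓣)
    → (is-pseudocontinuous pt D → ⨆≈-has-left-adjoint pt sq D)
    × (⨆≈-has-left-adjoint pt sq D → is-pseudocontinuous pt D)
proposition4p14 pt sq D = pseudocontinuous⇒⨆≈-has-left-adjoint , ⨆≈-has-left-adjoint⇒pseudocontinuous
  where open QuotientAdjoint pt sq D
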